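{- In a dagger kernel category $(\mathbb{X},\dagger)$ with finite $\dagger$-biproducts and negatives, a map $f$ has a generalized singular value decomposition if and only if $f$ is Moore-Penrose split.
   Context: Composition is in diagrammatic order. A dagger category is a category with an identity-on-objects contravariant involutive functor $\dagger$. Isometry: $s: A\to B$ with $ss^\dagger = 1_A$; unitary: $u$ with $uu^\dagger = 1$, $u^\dagger u = 1$. A $\dagger$-kernel of $g: A\to B$ is a kernel $k: \mathsf{ker}(g)\to A$ ($kg = 0$, universal) which is an isometry; a dagger kernel category is a dagger category with a zero object in which every map has a $\dagger$-kernel. Finite $\dagger$-biproducts: finite biproducts $\oplus$ whose projections $\pi_j$ and injections $\iota_j$ satisfy $\pi_j^\dagger = \iota_j$. Negatives: each hom-set, a commutative monoid under the biproduct-induced addition, is an abelian group. A Moore-Penrose inverse of $f: A\to B$ is $f^\circ: B\to A$ with $ff^\circ f = f$, $f^\circ f f^\circ = f^\circ$, $(ff^\circ)^\dagger = ff^\circ$, $(f^\circ f)^\dagger = f^\circ f$. A $\dagger$-idempotent $e$ $\dagger$-splits if $e = rr^\dagger$ with $r^\dagger r = 1$; $f$ is Moore-Penrose split if it has a Moore-Penrose inverse $f^\circ$ and $ff^\circ$, $f^\circ f$ both $\dagger$-split. A generalized singular value decomposition of $f: A\to B$ is a triple $(u: A\to X\oplus Z, d: X\to Y, v: Y\oplus W\to B)$ with $u, v$ unitary, $d$ an isomorphism and $f = u(d\oplus 0)v$. -}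

module Defs where

open import Level using (Level; _⊔_; suc)
open import Relation.Binary.PropositionalEquality using (_≡_)
open import Data.Product using (Σ; _×_; _,_; Σ-syntax)

-- A category whose hom-types carry propositional equality.
-- Composition is written in DIAGRAMMATIC order:  f ∙ g  means "first f, then g".
record Category (o ℓ : Level) : Set (suc (o ⊔ ℓ)) where
  infixr 9 _∙_
  field
    Obj   : Set o
    Hom   : Obj → Obj → Set ℓ
    id    : ∀ {A} → Hom A A
    _∙_   : ∀ {A B C} → Hom A B → Hom B C → Hom A C
    idˡ   : ∀ {A B} (f : Hom A B) → id ∙ f ≡ f
    idʳ   : ∀ {A B} (f : Hom A B) → f ∙ id ≡ f
    assoc : ∀ {A B C D} (f : Hom A B) (g : Hom B C) (h : Hom C D) →
            (f ∙ g) ∙ h ≡ f ∙ (g ∙ h)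

record DaggerCategory (o ℓ : Level) : Set (suc (o ⊔ ℓ)) where
  field
    cat : Category o ℓ
  open Category cat public
  field
    _† : ∀ {A B} → Hom A B → Hom B A
    †-id   : ∀ {A} → (id {A}) † ≡ id
    †-comp : ∀ {A B C} (f : Hom A B) (g : Hom B C) → (f ∙ g) † ≡ (g †) ∙ (f †)
    †-invol : ∀ {A B} (f : Hom A B) → (f †) † ≡ f

module DaggerNotions {o ℓ} (𝕏 : DaggerCategory o ℓ) where
  open DaggerCategory 𝕏

  IsIsometry : ∀ {A B} → Hom A B → Set ℓ
  IsIsometry s = s ∙ (s †) ≡ id

  IsUnitary : ∀ {A B} → Hom A B → Set ℓ
  IsUnitary u = (u ∙ (u †) ≡ id) × ((u †) ∙ u ≡ id)

  IsIso : ∀ {A B} → Hom A B → Set ℓ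
  IsIso {A} {B} d = Σ[ e ∈ Hom B A ] ((d ∙ e ≡ id) × (e ∙ d ≡ id))

  IsMPInverse : ∀ {A B} → Hom A B → Hom B A → Set ℓ
  IsMPInverse f g =
    (f ∙ g ∙ f ≡ f) × (g ∙ f ∙ g ≡ g) ×
    (((f ∙ g) † ≡ f ∙ g) × ((g ∙ f) † ≡ g ∙ f))

  DaggerSplits : ∀ {A} → Hom A A → Set (o ⊔ ℓ)
  DaggerSplits {A} e = Σ[ R ∈ Obj ] Σ[ r ∈ Hom A R ] ((e ≡ r ∙ (r †)) × ((r †) ∙ r ≡ id))

  MPSplit : ∀ {A B} → Hom A B → Set (o ⊔ ℓ)
  MPSplit {A} {B} f = Σ[ g ∈ Hom B A ] (IsMPInverse f g × DaggerSplits (f ∙ g) × DaggerSplits (g ∙ f))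

record ZeroObject {o ℓ} (C : Category o ℓ) : Set (o ⊔ ℓ) where
  open Category C
  field
    𝟎    : Obj
    !    : ∀ {A} → Hom A 𝟎
    ¡    : ∀ {A} → Hom 𝟎 A
    !-unique : ∀ {A} (f : Hom A 𝟎) → f ≡ !
    ¡-unique : ∀ {A} (f : Hom 𝟎 A) → f ≡ ¡
  0m : ∀ {A B} → Hom A B
  0m = ! ∙ ¡

record DaggerKernelCategory (o ℓ : Level) : Set (suc (o ⊔ ℓ)) where
  field
    dcat : DaggerCategory o ℓ
  open DaggerCategory dcat public
  open DaggerNotions dcat public
  field
    zero : ZeroObject cat
  open ZeroObject zero public
  field
    ker      : ∀ {A B} → Hom A B → Obj
    kerMap   : ∀ {A B} (g : Hom A B) → Hom (ker g) A
    ker-zero : ∀ {A B} (g : Hom A B) → kerMap g ∙ g ≡ 0m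
    ker-fac  : ∀ {A B C} (g : Hom A B) (h : Hom C A) → h ∙ g ≡ 0m → Hom C (ker g)
    ker-fac-eq : ∀ {A B C} (g : Hom A B) (h : Hom C A) (p : h ∙ g ≡ 0m) →
                 ker-fac g h p ∙ kerMap g ≡ h
    ker-fac-unique : ∀ {A B C} (g : Hom A B) (h : Hom C A) (p : h ∙ g ≡ 0m)
                     (m : Hom C (ker g)) → m ∙ kerMap g ≡ h → m ≡ ker-fac g h p
    ker-isometry : ∀ {A B} (g : Hom A B) → IsIsometry (kerMap g)

-- Dagger kernel category with finite dagger-biproducts (zero object = nullary biproduct;
-- binary dagger-biproducts given below) and negatives.
record DaggerKernelBiprodNeg (o ℓ : Level) : Set (suc (o ⊔ ℓ)) where
  field
    dkc : DaggerKernelCategory o ℓ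
  open DaggerKernelCategory dkc public
  infixr 6 _⊕_
  field
    _⊕_ : Obj → Obj → Obj
    π₁  : ∀ {A B} → Hom (A ⊕ B) A
    π₂  : ∀ {A B} → Hom (A ⊕ B) B
    ι₁  : ∀ {A B} → Hom A (A ⊕ B)
    ι₂  : ∀ {A B} → Hom B (A ⊕ B)
    ⟨_,_⟩ : ∀ {A B C} → Hom C A → Hom C B → Hom C (A ⊕ B)
    ⟨⟩-π₁ : ∀ {A B C} (f : Hom C A) (g : Hom C B) → ⟨ f , g ⟩ ∙ π₁ ≡ f
    ⟨⟩-π₂ : ∀ {A B C} (f : Hom C A) (g : Hom C B) → ⟨ f , g ⟩ ∙ π₂ ≡ g
    ⟨⟩-unique : ∀ {A B C} (f : Hom C A) (g : Hom C B) (h : Hom C (A ⊕ B)) →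
                h ∙ π₁ ≡ f → h ∙ π₂ ≡ g → h ≡ ⟨ f , g ⟩
    [_,_] : ∀ {A B C} → Hom A C → Hom B C → Hom (A ⊕ B) C
    ι₁-[] : ∀ {A B C} (f : Hom A C) (g : Hom B C) → ι₁ ∙ [ f , g ] ≡ f
    ι₂-[] : ∀ {A B C} (f : Hom A C) (g : Hom B C) → ι₂ ∙ [ f , g ] ≡ g
    []-unique : ∀ {A B C} (f : Hom A C) (g : Hom B C) (h : Hom (A ⊕ B) C) →
                ι₁ ∙ h ≡ f → ι₂ ∙ h ≡ g → h ≡ [ f , g ]
    ι₁π₁ : ∀ {A B} → ι₁ {A} {B} ∙ π₁ ≡ id
    ι₂π₂ : ∀ {A B} → ι₂ {A} {B} ∙ π₂ ≡ id
    ι₁π₂ : ∀ {A B} → ι₁ {A} {B} ∙ π₂ ≡ 0m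
    ι₂π₁ : ∀ {A B} → ι₂ {A} {B} ∙ π₁ ≡ 0m
    π₁† : ∀ {A B} → (π₁ {A} {B}) † ≡ ι₁
    π₂† : ∀ {A B} → (π₂ {A} {B}) † ≡ ι₂

  _⊕₁_ : ∀ {A B C D} → Hom A C → Hom B D → Hom (A ⊕ B) (C ⊕ D)
  f ⊕₁ g = ⟨ π₁ ∙ f , π₂ ∙ g ⟩

  _+_ : ∀ {A B} → Hom A B → Hom A B → Hom A B
  f + g = ⟨ id , id ⟩ ∙ (f ⊕₁ g) ∙ [ id , id ]

  field
    neg      : ∀ {A B} → Hom A B → Hom A B
    neg-inv  : ∀ {A B} (f : Hom A B) → f + neg f ≡ 0m

  GSVD : ∀ {A B} → Hom A B → Set (o ⊔ ℓ)
  GSVD {A} {B} f =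
    Σ[ X ∈ Obj ] Σ[ Z ∈ Obj ] Σ[ Y ∈ Obj ] Σ[ W ∈ Obj ]
    Σ[ u ∈ Hom A (X ⊕ Z) ] Σ[ d ∈ Hom X Y ] Σ[ v ∈ Hom (Y ⊕ W) B ]
      (IsUnitary u × IsIso d × IsUnitary v × (f ≡ u ∙ (d ⊕₁ 0m {Z} {W}) ∙ v))

-- If f = u (d ⊕ 0) v, then f is a unitary conjugate of d ⊕ 0, whose Moore–Penrose inverse
-- is d⁻¹ ⊕ 0 with both idempotents equal to id ⊕ 0 = π₁ π₁†; unitaries transport Moore–Penrose
-- inverses and †-splittings. Conversely, if f f° = r r† and f° f = s s†, then
-- f = r (r† f s) s†, the core r† f s is inverse to s† f° r, and r, s extend to the unitaries
-- ⟨r, ker(r)†⟩ and ⟨s, ker(s)†⟩. Such an extension u satisfies u† u = 1 by the kernel equations,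
-- and is monic because a map killed by both r and ker(r)† factors through ker(r) and vanishes;
-- negatives turn this into cancellability, whence also u u† = 1.
module Submission where

open import Defs
open import Data.Product using (_×_; _,_)
open import Relation.Binary.PropositionalEquality
  using (_≡_; sym; trans; cong; cong₂; subst; module ≡-Reasoning)

module _ {o ℓ} (𝕏 : DaggerKernelBiprodNeg o ℓ) where
  open DaggerKernelBiprodNeg 𝕏
  open ≡-Reasoning

  pullˡ : ∀ {A B C D} {a : Hom A B} {b : Hom B C} {c : Hom A C} {x : Hom C D} →
          a ∙ b ≡ c → a ∙ b ∙ x ≡ c ∙ x
  pullˡ {a = a} {b} {x = x} p = trans (sym (assoc a b x)) (cong (_∙ x) p)

  cancelˡ : ∀ {A B C} {a : Hom A B} {b : Hom B A} {x : Hom A C} →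
            a ∙ b ≡ id → a ∙ b ∙ x ≡ x
  cancelˡ {x = x} p = trans (pullˡ p) (idˡ x)

  cancel-middle : ∀ {A X Y B Z C} {x : Hom A X} {a : Hom X Y} {y : Hom Y B}
                  {y′ : Hom B Y} {b : Hom Y Z} {x′ : Hom Z C} →
                  y ∙ y′ ≡ id → (x ∙ a ∙ y) ∙ (y′ ∙ b ∙ x′) ≡ x ∙ (a ∙ b) ∙ x′
  cancel-middle {x = x} {a} {y} {y′} {b} {x′} yy′≡id = begin
    (x ∙ a ∙ y) ∙ y′ ∙ b ∙ x′  ≡⟨ assoc x _ _ ⟩
    x ∙ (a ∙ y) ∙ y′ ∙ b ∙ x′  ≡⟨ cong (x ∙_) (assoc a y _) ⟩
    x ∙ a ∙ y ∙ y′ ∙ b ∙ x′    ≡⟨ cong (λ w → x ∙ a ∙ w) (cancelˡ yy′≡id) ⟩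
    x ∙ a ∙ b ∙ x′             ≡⟨ cong (x ∙_) (sym (assoc a b x′)) ⟩
    x ∙ (a ∙ b) ∙ x′           ∎

  0∙ : ∀ {A B C} (f : Hom B C) → 0m {A} ∙ f ≡ 0m
  0∙ f = trans (assoc ! ¡ f) (cong (! ∙_) (¡-unique (¡ ∙ f)))

  ∙0 : ∀ {A B C} (f : Hom A B) → f ∙ 0m {B} {C} ≡ 0m
  ∙0 f = trans (sym (assoc f ! ¡)) (cong (_∙ ¡) (!-unique (f ∙ !)))

  0† : ∀ {A B} → 0m {A} {B} † ≡ 0m
  0† = trans (†-comp ! ¡) (cong₂ _∙_ (!-unique (¡ †)) (¡-unique (! †)))

  ∙⟨⟩ : ∀ {A B C D} (h : Hom D C) (f : Hom C A) (g : Hom C B) →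
        h ∙ ⟨ f , g ⟩ ≡ ⟨ h ∙ f , h ∙ g ⟩
  ∙⟨⟩ h f g = ⟨⟩-unique _ _ _
    (trans (assoc h _ π₁) (cong (h ∙_) (⟨⟩-π₁ f g)))
    (trans (assoc h _ π₂) (cong (h ∙_) (⟨⟩-π₂ f g)))

  []∙ : ∀ {A B C D} (f : Hom A C) (g : Hom B C) (h : Hom C D) →
        [ f , g ] ∙ h ≡ [ f ∙ h , g ∙ h ]
  []∙ f g h = []-unique _ _ _
    (trans (sym (assoc ι₁ _ h)) (cong (_∙ h) (ι₁-[] f g)))
    (trans (sym (assoc ι₂ _ h)) (cong (_∙ h) (ι₂-[] f g)))

  ⟨,0⟩ : ∀ {A B C} (f : Hom C A) → ⟨ f , 0m {C} {B} ⟩ ≡ f ∙ ι₁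
  ⟨,0⟩ f = sym (⟨⟩-unique _ _ _
    (trans (assoc f ι₁ π₁) (trans (cong (f ∙_) ι₁π₁) (idʳ f)))
    (trans (assoc f ι₁ π₂) (trans (cong (f ∙_) ι₁π₂) (∙0 f))))

  ⟨0,⟩ : ∀ {A B C} (g : Hom C B) → ⟨ 0m {C} {A} , g ⟩ ≡ g ∙ ι₂
  ⟨0,⟩ g = sym (⟨⟩-unique _ _ _
    (trans (assoc g ι₂ π₁) (trans (cong (g ∙_) ι₂π₁) (∙0 g)))
    (trans (assoc g ι₂ π₂) (trans (cong (g ∙_) ι₂π₂) (idʳ g))))

  []-η : ∀ {A B} → [ ι₁ , ι₂ ] ≡ id {A ⊕ B}
  []-η = sym ([]-unique ι₁ ι₂ id (idʳ ι₁) (idʳ ι₂))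

  ⟨[]⟩≡[⟨⟩] : ∀ {A B C D} (a : Hom A C) (b : Hom B C) (c : Hom A D) (d : Hom B D) →
              ⟨ [ a , b ] , [ c , d ] ⟩ ≡ [ ⟨ a , c ⟩ , ⟨ b , d ⟩ ]
  ⟨[]⟩≡[⟨⟩] a b c d = []-unique _ _ _
    (trans (∙⟨⟩ ι₁ _ _) (cong₂ ⟨_,_⟩ (ι₁-[] a b) (ι₁-[] c d)))
    (trans (∙⟨⟩ ι₂ _ _) (cong₂ ⟨_,_⟩ (ι₂-[] a b) (ι₂-[] c d)))

  ⟨⟩† : ∀ {A B C} (f : Hom C A) (g : Hom C B) → ⟨ f , g ⟩ † ≡ [ f † , g † ]
  ⟨⟩† f g = []-unique _ _ _
    (trans (cong (_∙ _) (sym π₁†)) (trans (sym (†-comp ⟨ f , g ⟩ π₁)) (cong _† (⟨⟩-π₁ f g))))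
    (trans (cong (_∙ _) (sym π₂†)) (trans (sym (†-comp ⟨ f , g ⟩ π₂)) (cong _† (⟨⟩-π₂ f g))))

  ⟨⟩∙⊕₁ : ∀ {A B C D E} (f : Hom E A) (g : Hom E B) (h : Hom A C) (k : Hom B D) →
          ⟨ f , g ⟩ ∙ (h ⊕₁ k) ≡ ⟨ f ∙ h , g ∙ k ⟩
  ⟨⟩∙⊕₁ f g h k = trans (∙⟨⟩ _ _ _) (cong₂ ⟨_,_⟩ (pullˡ (⟨⟩-π₁ f g)) (pullˡ (⟨⟩-π₂ f g)))

  ⊕₁-∙ : ∀ {A B C D E F} (f : Hom A C) (g : Hom B D) (h : Hom C E) (k : Hom D F) →
         (f ⊕₁ g) ∙ (h ⊕₁ k) ≡ (f ∙ h) ⊕₁ (g ∙ k)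
  ⊕₁-∙ f g h k = trans (⟨⟩∙⊕₁ _ _ h k) (cong₂ ⟨_,_⟩ (assoc π₁ f h) (assoc π₂ g k))

  ι₁∙⊕₁ : ∀ {A B C D} (f : Hom A C) (g : Hom B D) → ι₁ ∙ (f ⊕₁ g) ≡ f ∙ ι₁
  ι₁∙⊕₁ f g = trans (∙⟨⟩ ι₁ _ _)
    (trans (cong₂ ⟨_,_⟩ (cancelˡ ι₁π₁) (trans (pullˡ ι₁π₂) (0∙ g))) (⟨,0⟩ f))

  ι₂∙⊕₁ : ∀ {A B C D} (f : Hom A C) (g : Hom B D) → ι₂ ∙ (f ⊕₁ g) ≡ g ∙ ι₂
  ι₂∙⊕₁ f g = trans (∙⟨⟩ ι₂ _ _)
    (trans (cong₂ ⟨_,_⟩ (trans (pullˡ ι₂π₁) (0∙ f)) (cancelˡ ι₂π₂)) (⟨0,⟩ g))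

  ⊕₁∙[] : ∀ {A B C D E} (f : Hom A C) (g : Hom B D) (h : Hom C E) (k : Hom D E) →
          (f ⊕₁ g) ∙ [ h , k ] ≡ [ f ∙ h , g ∙ k ]
  ⊕₁∙[] f g h k = []-unique _ _ _
    (trans (pullˡ (ι₁∙⊕₁ f g)) (trans (assoc f ι₁ _) (cong (f ∙_) (ι₁-[] h k))))
    (trans (pullˡ (ι₂∙⊕₁ f g)) (trans (assoc g ι₂ _) (cong (g ∙_) (ι₂-[] h k))))

  ⊕0-∙ : ∀ {A B C Z W V} (f : Hom A B) (g : Hom B C) →
         (f ⊕₁ 0m {Z} {W}) ∙ (g ⊕₁ 0m {W} {V}) ≡ (f ∙ g) ⊕₁ 0m
  ⊕0-∙ f g = trans (⊕₁-∙ f 0m g 0m) (cong ((f ∙ g) ⊕₁_) (0∙ 0m))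

  Δ : ∀ {A} → Hom A (A ⊕ A)
  Δ = ⟨ id , id ⟩

  ∇ : ∀ {A} → Hom (A ⊕ A) A
  ∇ = [ id , id ]

  +-via-⟨⟩ : ∀ {A B} (f g : Hom A B) → f + g ≡ ⟨ f , g ⟩ ∙ ∇
  +-via-⟨⟩ f g = trans (sym (assoc Δ (f ⊕₁ g) ∇))
    (cong (_∙ ∇) (trans (⟨⟩∙⊕₁ id id f g) (cong₂ ⟨_,_⟩ (idˡ f) (idˡ g))))

  +-via-[] : ∀ {A B} (f g : Hom A B) → f + g ≡ Δ ∙ [ f , g ]
  +-via-[] f g = cong (Δ ∙_) (trans (⊕₁∙[] f g id id) (cong₂ [_,_] (idʳ f) (idʳ g)))

  +-identityʳ : ∀ {A B} (f : Hom A B) → f + 0m ≡ f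
  +-identityʳ f = trans (+-via-⟨⟩ f 0m)
    (trans (cong (_∙ ∇) (⟨,0⟩ f)) (trans (assoc f ι₁ ∇) (trans (cong (f ∙_) (ι₁-[] id id)) (idʳ f))))

  +-identityˡ : ∀ {A B} (f : Hom A B) → 0m + f ≡ f
  +-identityˡ f = trans (+-via-⟨⟩ 0m f)
    (trans (cong (_∙ ∇) (⟨0,⟩ f)) (trans (assoc f ι₂ ∇) (trans (cong (f ∙_) (ι₂-[] id id)) (idʳ f))))

  +-distribʳ : ∀ {A B C} (f g : Hom A B) (h : Hom B C) → (f + g) ∙ h ≡ (f ∙ h) + (g ∙ h)
  +-distribʳ f g h = begin
    (f + g) ∙ h            ≡⟨ cong (_∙ h) (+-via-[] f g) ⟩
    (Δ ∙ [ f , g ]) ∙ h    ≡⟨ assoc Δ _ h ⟩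
    Δ ∙ [ f , g ] ∙ h      ≡⟨ cong (Δ ∙_) ([]∙ f g h) ⟩
    Δ ∙ [ f ∙ h , g ∙ h ]  ≡⟨ sym (+-via-[] _ _) ⟩
    (f ∙ h) + (g ∙ h)      ∎

  +-interchange : ∀ {A B} (a b c d : Hom A B) → (a + b) + (c + d) ≡ (a + c) + (b + d)
  +-interchange a b c d = begin
    (a + b) + (c + d)                         ≡⟨ +-via-⟨⟩ _ _ ⟩
    ⟨ a + b , c + d ⟩ ∙ ∇                      ≡⟨ cong (_∙ ∇) (cong₂ ⟨_,_⟩ (+-via-[] a b) (+-via-[] c d)) ⟩
    ⟨ Δ ∙ [ a , b ] , Δ ∙ [ c , d ] ⟩ ∙ ∇     ≡⟨ cong (_∙ ∇) (sym (∙⟨⟩ Δ _ _)) ⟩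
    (Δ ∙ ⟨ [ a , b ] , [ c , d ] ⟩) ∙ ∇       ≡⟨ assoc Δ _ ∇ ⟩
    Δ ∙ ⟨ [ a , b ] , [ c , d ] ⟩ ∙ ∇         ≡⟨ cong (λ m → Δ ∙ m ∙ ∇) (⟨[]⟩≡[⟨⟩] a b c d) ⟩
    Δ ∙ [ ⟨ a , c ⟩ , ⟨ b , d ⟩ ] ∙ ∇         ≡⟨ cong (Δ ∙_) ([]∙ _ _ ∇) ⟩
    Δ ∙ [ ⟨ a , c ⟩ ∙ ∇ , ⟨ b , d ⟩ ∙ ∇ ]     ≡⟨ cong (Δ ∙_) (cong₂ [_,_] (sym (+-via-⟨⟩ a c)) (sym (+-via-⟨⟩ b d))) ⟩
    Δ ∙ [ a + c , b + d ]                      ≡⟨ sym (+-via-[] _ _) ⟩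
    (a + c) + (b + d)                          ∎

  -- Eckmann–Hilton: the interchange law with the units yields associativity.
  +-assoc : ∀ {A B} (f g h : Hom A B) → (f + g) + h ≡ f + (g + h)
  +-assoc f g h = begin
    (f + g) + h         ≡⟨ cong ((f + g) +_) (sym (+-identityˡ h)) ⟩
    (f + g) + (0m + h)  ≡⟨ +-interchange f g 0m h ⟩
    (f + 0m) + (g + h)  ≡⟨ cong (_+ (g + h)) (+-identityʳ f) ⟩
    f + (g + h)         ∎

  +-inverseˡ-unique : ∀ {A B} (f g : Hom A B) → f + g ≡ 0m → f ≡ neg g
  +-inverseˡ-unique f g f+g≡0 = begin
    f                 ≡⟨ sym (+-identityʳ f) ⟩
    f + 0m            ≡⟨ cong (f +_) (sym (neg-inv g)) ⟩
    f + (g + neg g)   ≡⟨ sym (+-assoc f g (neg g)) ⟩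
    (f + g) + neg g   ≡⟨ cong (_+ neg g) f+g≡0 ⟩
    0m + neg g        ≡⟨ +-identityˡ (neg g) ⟩
    neg g             ∎

  reflects-0⇒mono : ∀ {A B} (m : Hom A B) →
                    (∀ {C} (z : Hom C A) → z ∙ m ≡ 0m → z ≡ 0m) →
                    ∀ {C} (x y : Hom C A) → x ∙ m ≡ y ∙ m → x ≡ y
  reflects-0⇒mono m reflects-0 x y x∙m≡y∙m =
    trans (+-inverseˡ-unique x (neg y) (reflects-0 (x + neg y) difference-vanishes))
          (sym (+-inverseˡ-unique y (neg y) (neg-inv y)))
    where
      difference-vanishes : (x + neg y) ∙ m ≡ 0m
      difference-vanishes = begin
        (x + neg y) ∙ m        ≡⟨ +-distribʳ x (neg y) m ⟩
        (x ∙ m) + (neg y ∙ m)  ≡⟨ cong (_+ (neg y ∙ m)) x∙m≡y∙m ⟩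
        (y ∙ m) + (neg y ∙ m)  ≡⟨ sym (+-distribʳ y (neg y) m) ⟩
        (y + neg y) ∙ m        ≡⟨ cong (_∙ m) (neg-inv y) ⟩
        0m ∙ m                 ≡⟨ 0∙ m ⟩
        0m                     ∎

  IsUnitary-† : ∀ {A B} {u : Hom A B} → IsUnitary u → IsUnitary (u †)
  IsUnitary-† {u = u} (uu†≡id , u†u≡id) =
    trans (cong (u † ∙_) (†-invol u)) u†u≡id , trans (cong (_∙ u †) (†-invol u)) uu†≡id

  mono⇒unitary : ∀ {A B} (u : Hom A B) → u † ∙ u ≡ id →
                 (∀ (x y : Hom A A) → x ∙ u ≡ y ∙ u → x ≡ y) → IsUnitary u
  mono⇒unitary u u†u≡id mono = mono (u ∙ u †) id uu†u≡u , u†u≡id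
    where
      uu†u≡u : (u ∙ u †) ∙ u ≡ id ∙ u
      uu†u≡u = trans (assoc u (u †) u)
        (trans (cong (u ∙_) u†u≡id) (trans (idʳ u) (sym (idˡ u))))

  complete : ∀ {A R} (r : Hom A R) → Hom A (R ⊕ ker r)
  complete r = ⟨ r , kerMap r † ⟩

  complete-† : ∀ {A R} (r : Hom A R) → complete r † ≡ [ r † , kerMap r ]
  complete-† r = trans (⟨⟩† r (kerMap r †)) (cong (λ k → [ r † , k ]) (†-invol (kerMap r)))

  complete-reflects-0 : ∀ {A R} (r : Hom A R) {C} (x : Hom C A) → x ∙ complete r ≡ 0m → x ≡ 0m
  complete-reflects-0 r x x∙c≡0 = begin
    x       ≡⟨ sym (ker-fac-eq r x x∙r≡0) ⟩
    h ∙ k   ≡⟨ cong (_∙ k) h≡0 ⟩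
    0m ∙ k  ≡⟨ 0∙ k ⟩
    0m      ∎
    where
      k = kerMap r
      x∙r≡0 : x ∙ r ≡ 0m
      x∙r≡0 = trans (cong (x ∙_) (sym (⟨⟩-π₁ r (k †)))) (trans (pullˡ x∙c≡0) (0∙ π₁))
      x∙k†≡0 : x ∙ k † ≡ 0m
      x∙k†≡0 = trans (cong (x ∙_) (sym (⟨⟩-π₂ r (k †)))) (trans (pullˡ x∙c≡0) (0∙ π₂))
      h = ker-fac r x x∙r≡0
      h≡0 : h ≡ 0m
      h≡0 = begin
        h            ≡⟨ sym (idʳ h) ⟩
        h ∙ id       ≡⟨ cong (h ∙_) (sym (ker-isometry r)) ⟩
        h ∙ k ∙ k †  ≡⟨ pullˡ (ker-fac-eq r x x∙r≡0) ⟩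
        x ∙ k †      ≡⟨ x∙k†≡0 ⟩
        0m           ∎

  complete-†∙complete : ∀ {A R} (r : Hom A R) → r † ∙ r ≡ id → complete r † ∙ complete r ≡ id
  complete-†∙complete r r†r≡id = begin
    complete r † ∙ complete r                            ≡⟨ cong (_∙ complete r) (complete-† r) ⟩
    [ r † , k ] ∙ complete r                             ≡⟨ []∙ _ _ _ ⟩
    [ r † ∙ complete r , k ∙ complete r ]                ≡⟨ cong₂ [_,_] (∙⟨⟩ _ _ _) (∙⟨⟩ _ _ _) ⟩
    [ ⟨ r † ∙ r , r † ∙ k † ⟩ , ⟨ k ∙ r , k ∙ k † ⟩ ]    ≡⟨ cong₂ [_,_] (cong₂ ⟨_,_⟩ r†r≡id r†k†≡0)
                                                                        (cong₂ ⟨_,_⟩ (ker-zero r) (ker-isometry r)) ⟩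
    [ ⟨ id , 0m ⟩ , ⟨ 0m , id ⟩ ]                        ≡⟨ cong₂ [_,_] (trans (⟨,0⟩ id) (idˡ ι₁))
                                                                        (trans (⟨0,⟩ id) (idˡ ι₂)) ⟩
    [ ι₁ , ι₂ ]                                          ≡⟨ []-η ⟩
    id                                                   ∎
    where
      k = kerMap r
      r†k†≡0 : r † ∙ k † ≡ 0m
      r†k†≡0 = trans (sym (†-comp k r)) (trans (cong _† (ker-zero r)) 0†)

  complete-unitary : ∀ {A R} (r : Hom A R) → r † ∙ r ≡ id → IsUnitary (complete r)
  complete-unitary r r†r≡id = mono⇒unitary (complete r) (complete-†∙complete r r†r≡id)
    (reflects-0⇒mono (complete r) (complete-reflects-0 r))

  DaggerSplits⇒self-adjoint : ∀ {A} {e : Hom A A} → DaggerSplits e → e † ≡ e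
  DaggerSplits⇒self-adjoint {e = e} (_ , r , e≡rr† , _) =
    trans (cong _† e≡rr†) (trans (†-comp r (r †)) (trans (cong (_∙ r †) (†-invol r)) (sym e≡rr†)))

  DaggerSplits-conj : ∀ {A X} (u : Hom A X) {e : Hom X X} → u † ∙ u ≡ id →
                      DaggerSplits e → DaggerSplits (u ∙ e ∙ u †)
  DaggerSplits-conj u {e} u†u≡id (R , r , e≡rr† , r†r≡id) = R , u ∙ r , split , retract
    where
      split : u ∙ e ∙ u † ≡ (u ∙ r) ∙ (u ∙ r) †
      split = begin
        u ∙ e ∙ u †          ≡⟨ cong (λ w → u ∙ w ∙ u †) e≡rr† ⟩
        u ∙ (r ∙ r †) ∙ u †  ≡⟨ cong (u ∙_) (assoc r (r †) (u †)) ⟩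
        u ∙ r ∙ r † ∙ u †    ≡⟨ sym (assoc u r _) ⟩
        (u ∙ r) ∙ r † ∙ u †  ≡⟨ cong ((u ∙ r) ∙_) (sym (†-comp u r)) ⟩
        (u ∙ r) ∙ (u ∙ r) †  ∎
      retract : (u ∙ r) † ∙ (u ∙ r) ≡ id
      retract = begin
        (u ∙ r) † ∙ u ∙ r    ≡⟨ cong (_∙ (u ∙ r)) (†-comp u r) ⟩
        (r † ∙ u †) ∙ u ∙ r  ≡⟨ assoc (r †) (u †) _ ⟩
        r † ∙ u † ∙ u ∙ r    ≡⟨ cong (r † ∙_) (cancelˡ u†u≡id) ⟩
        r † ∙ r              ≡⟨ r†r≡id ⟩
        id                   ∎

  DaggerSplits-conj′ : ∀ {A X} (v : Hom X A) {e : Hom X X} → v ∙ v † ≡ id →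
                       DaggerSplits e → DaggerSplits (v † ∙ e ∙ v)
  DaggerSplits-conj′ v {e} vv†≡id e-splits =
    subst (λ w → DaggerSplits (v † ∙ e ∙ w)) (†-invol v)
      (DaggerSplits-conj (v †) (trans (cong (_∙ v †) (†-invol v)) vv†≡id) e-splits)

  MPSplit-intro : ∀ {A B} (f : Hom A B) (g : Hom B A) → f ∙ g ∙ f ≡ f → g ∙ f ∙ g ≡ g →
                  DaggerSplits (f ∙ g) → DaggerSplits (g ∙ f) → MPSplit f
  MPSplit-intro f g fgf≡f gfg≡g fg-splits gf-splits =
    g , (fgf≡f , gfg≡g , DaggerSplits⇒self-adjoint fg-splits , DaggerSplits⇒self-adjoint gf-splits) ,
    fg-splits , gf-splits

  MPSplit-unitary-∙ : ∀ {A X Y B} {u : Hom A X} {g : Hom X Y} {v : Hom Y B} →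
                      IsUnitary u → IsUnitary v → MPSplit g → MPSplit (u ∙ g ∙ v)
  MPSplit-unitary-∙ {u = u} {g} {v} (_ , u†u≡id) (vv†≡id , _)
                    (h , (ghg≡g , hgh≡h , _ , _) , gh-splits , hg-splits) =
    MPSplit-intro F H FHF≡F HFH≡H
      (subst DaggerSplits (sym FH≡) (DaggerSplits-conj u u†u≡id gh-splits))
      (subst DaggerSplits (sym HF≡) (DaggerSplits-conj′ v vv†≡id hg-splits))
    where
      F = u ∙ g ∙ v
      H = v † ∙ h ∙ u †
      FH≡ : F ∙ H ≡ u ∙ (g ∙ h) ∙ u †
      FH≡ = cancel-middle vv†≡id
      HF≡ : H ∙ F ≡ v † ∙ (h ∙ g) ∙ v
      HF≡ = cancel-middle u†u≡id
      FHF≡F : F ∙ H ∙ F ≡ F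
      FHF≡F = trans (cong (F ∙_) HF≡) (trans (cancel-middle vv†≡id) (cong (λ w → u ∙ w ∙ v) ghg≡g))
      HFH≡H : H ∙ F ∙ H ≡ H
      HFH≡H = trans (cong (H ∙_) FH≡) (trans (cancel-middle u†u≡id) (cong (λ w → v † ∙ w ∙ u †) hgh≡h))

  id⊕0-splits : ∀ {X Z} → DaggerSplits (id {X} ⊕₁ 0m {Z} {Z})
  id⊕0-splits {X} = X , π₁ , id⊕0≡π₁π₁† , trans (cong (_∙ π₁) π₁†) ι₁π₁
    where
      id⊕0≡π₁π₁† : id ⊕₁ 0m ≡ π₁ ∙ π₁ †
      id⊕0≡π₁π₁† = trans (cong₂ ⟨_,_⟩ (idʳ π₁) (∙0 π₂))
        (trans (⟨,0⟩ π₁) (cong (π₁ ∙_) (sym π₁†)))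

  ⊕0-regular : ∀ {P Q Z W} {a : Hom P Q} {b : Hom Q P} → b ∙ a ≡ id →
               (a ⊕₁ 0m {Z} {W}) ∙ (b ⊕₁ 0m {W} {Z}) ∙ (a ⊕₁ 0m {Z} {W}) ≡ a ⊕₁ 0m
  ⊕0-regular {a = a} {b} ba≡id = begin
    (a ⊕₁ 0m) ∙ (b ⊕₁ 0m) ∙ (a ⊕₁ 0m)  ≡⟨ cong ((a ⊕₁ 0m) ∙_) (⊕0-∙ b a) ⟩
    (a ⊕₁ 0m) ∙ ((b ∙ a) ⊕₁ 0m)         ≡⟨ ⊕0-∙ a (b ∙ a) ⟩
    (a ∙ b ∙ a) ⊕₁ 0m                   ≡⟨ cong (_⊕₁ 0m) (trans (cong (a ∙_) ba≡id) (idʳ a)) ⟩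
    a ⊕₁ 0m                             ∎

  ⊕0-inverse-splits : ∀ {P Q Z W} {a : Hom P Q} {b : Hom Q P} → a ∙ b ≡ id →
                      DaggerSplits ((a ⊕₁ 0m {Z} {W}) ∙ (b ⊕₁ 0m {W} {Z}))
  ⊕0-inverse-splits {a = a} {b} ab≡id =
    subst DaggerSplits (sym (trans (⊕0-∙ a b) (cong (_⊕₁ 0m) ab≡id))) id⊕0-splits

  MPSplit-⊕0 : ∀ {X Y Z W} {d : Hom X Y} → IsIso d → MPSplit (d ⊕₁ 0m {Z} {W})
  MPSplit-⊕0 {d = d} (e , de≡id , ed≡id) =
    MPSplit-intro (d ⊕₁ 0m) (e ⊕₁ 0m) (⊕0-regular ed≡id) (⊕0-regular de≡id)
      (⊕0-inverse-splits de≡id) (⊕0-inverse-splits ed≡id)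

  GSVD⇒MPSplit : ∀ {A B} (f : Hom A B) → GSVD f → MPSplit f
  GSVD⇒MPSplit f (_ , _ , _ , _ , _ , _ , _ , u-unitary , d-iso , v-unitary , f≡u[d⊕0]v) =
    subst MPSplit (sym f≡u[d⊕0]v) (MPSplit-unitary-∙ u-unitary v-unitary (MPSplit-⊕0 d-iso))

  core-inverse : ∀ {A B R S} {f : Hom A B} {g : Hom B A} {r : Hom A R} {s : Hom B S} →
                 f ∙ g ∙ f ≡ f → f ∙ g ≡ r ∙ r † → g ∙ f ≡ s ∙ s † → r † ∙ r ≡ id →
                 (r † ∙ f ∙ s) ∙ (s † ∙ g ∙ r) ≡ id
  core-inverse {f = f} {g} {r} {s} fgf≡f fg≡rr† gf≡ss† r†r≡id = begin
    (r † ∙ f ∙ s) ∙ s † ∙ g ∙ r  ≡⟨ assoc (r †) (f ∙ s) _ ⟩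
    r † ∙ (f ∙ s) ∙ s † ∙ g ∙ r  ≡⟨ cong (r † ∙_) (assoc f s _) ⟩
    r † ∙ f ∙ s ∙ s † ∙ g ∙ r    ≡⟨ cong (λ w → r † ∙ f ∙ w) (pullˡ (sym gf≡ss†)) ⟩
    r † ∙ f ∙ (g ∙ f) ∙ g ∙ r    ≡⟨ cong (r † ∙_) (pullˡ fgf≡f) ⟩
    r † ∙ f ∙ g ∙ r              ≡⟨ cong (r † ∙_) (pullˡ fg≡rr†) ⟩
    r † ∙ (r ∙ r †) ∙ r          ≡⟨ cong (r † ∙_) (assoc r (r †) r) ⟩
    r † ∙ r ∙ r † ∙ r            ≡⟨ cancelˡ r†r≡id ⟩
    r † ∙ r                      ≡⟨ r†r≡id ⟩
    id                           ∎

  core-factorisation : ∀ {A B R S} {f : Hom A B} {g : Hom B A} {r : Hom A R} {s : Hom B S} →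
                       f ∙ g ∙ f ≡ f → f ∙ g ≡ r ∙ r † → g ∙ f ≡ s ∙ s † →
                       r ∙ (r † ∙ f ∙ s) ∙ s † ≡ f
  core-factorisation {f = f} {g} {r} {s} fgf≡f fg≡rr† gf≡ss† = begin
    r ∙ (r † ∙ f ∙ s) ∙ s †  ≡⟨ cong (r ∙_) (assoc (r †) (f ∙ s) (s †)) ⟩
    r ∙ r † ∙ (f ∙ s) ∙ s †  ≡⟨ cong (λ w → r ∙ r † ∙ w) (assoc f s (s †)) ⟩
    r ∙ r † ∙ f ∙ s ∙ s †    ≡⟨ pullˡ (sym fg≡rr†) ⟩
    (f ∙ g) ∙ f ∙ s ∙ s †    ≡⟨ assoc f g _ ⟩
    f ∙ g ∙ f ∙ s ∙ s †      ≡⟨ cong (λ w → f ∙ g ∙ f ∙ w) (sym gf≡ss†) ⟩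
    f ∙ g ∙ f ∙ g ∙ f        ≡⟨ cong (λ w → f ∙ g ∙ w) fgf≡f ⟩
    f ∙ g ∙ f                ≡⟨ fgf≡f ⟩
    f                        ∎

  MPSplit⇒GSVD : ∀ {A B} (f : Hom A B) → MPSplit f → GSVD f
  MPSplit⇒GSVD f (g , (fgf≡f , gfg≡g , _ , _) , (R , r , fg≡rr† , r†r≡id) , (S , s , gf≡ss† , s†s≡id)) =
    R , ker r , S , ker s , complete r , d , complete s † ,
    complete-unitary r r†r≡id ,
    (s † ∙ g ∙ r , core-inverse fgf≡f fg≡rr† gf≡ss† r†r≡id , core-inverse gfg≡g gf≡ss† fg≡rr† s†s≡id) ,
    IsUnitary-† (complete-unitary s s†s≡id) ,
    sym factorisation
    where
      d = r † ∙ f ∙ s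
      factorisation : complete r ∙ (d ⊕₁ 0m) ∙ complete s † ≡ f
      factorisation = begin
        complete r ∙ (d ⊕₁ 0m) ∙ complete s †      ≡⟨ sym (assoc _ _ _) ⟩
        (complete r ∙ (d ⊕₁ 0m)) ∙ complete s †    ≡⟨ cong (_∙ complete s †) (⟨⟩∙⊕₁ r _ d 0m) ⟩
        ⟨ r ∙ d , kerMap r † ∙ 0m ⟩ ∙ complete s †  ≡⟨ cong (λ w → ⟨ r ∙ d , w ⟩ ∙ complete s †) (∙0 _) ⟩
        ⟨ r ∙ d , 0m ⟩ ∙ complete s †               ≡⟨ cong (_∙ complete s †) (⟨,0⟩ (r ∙ d)) ⟩
        ((r ∙ d) ∙ ι₁) ∙ complete s †               ≡⟨ assoc _ ι₁ _ ⟩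
        (r ∙ d) ∙ ι₁ ∙ complete s †                 ≡⟨ cong (λ w → (r ∙ d) ∙ ι₁ ∙ w) (complete-† s) ⟩
        (r ∙ d) ∙ ι₁ ∙ [ s † , kerMap s ]           ≡⟨ cong ((r ∙ d) ∙_) (ι₁-[] _ _) ⟩
        (r ∙ d) ∙ s †                               ≡⟨ assoc r d (s †) ⟩
        r ∙ d ∙ s †                                 ≡⟨ core-factorisation fgf≡f fg≡rr† gf≡ss† ⟩
        f                                           ∎

mainTheorem16 : ∀ {o ℓ} (𝕏 : DaggerKernelBiprodNeg o ℓ) →
    let open DaggerKernelBiprodNeg 𝕏 in
    ∀ {A B} (f : Hom A B) → (GSVD f → MPSplit f) × (MPSplit f → GSVD f)
mainTheorem16 𝕏 f = GSVD⇒MPSplit 𝕏 f , MPSplit⇒GSVD 𝕏 f
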